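{- The sequence $a_n=\sum_{k\ge 0}\frac{(2k)!}{k!\,2^k}\binom{n+1}{2k+1}$ ($n\ge 0$) satisfies $a_0=1$, $a_1=2$, $a_2=4$, and $$a_n=2a_{n-1}+(n-2)a_{n-2}-(n-1)a_{n-3}\quad\text{for } n\ge 3.$$ -}

module Defs where

open import Data.Nat using (ℕ; zero; suc; _+_; _*_; _^_; _/_; _!)
open import Data.Nat.Combinatorics using (_C_)
open import Data.Nat.Properties using (m*n≢0; m^n≢0; _!≢0)
open import Data.List using (map; upTo)
open import Data.Nat.ListAction using (sum)

-- (2k)! / (k! 2^k): an exact quotient (it equals the double factorial (2k-1)!!).
dfact : ℕ → ℕ
dfact k = ((2 * k) ! / (k ! * 2 ^ k)) {{m*n≢0 (k !) (2 ^ k) {{k !≢0}} {{m^n≢0 2 k}}}}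

term : ℕ → ℕ → ℕ
term n k = dfact k * ((n + 1) C (2 * k + 1))

-- a n = Σ_{k ≥ 0} (2k)!/(k! 2^k) * C(n+1, 2k+1).  For k > n we have
-- 2k+1 > n+1 so the binomial vanishes; summing k = 0 .. n is the full sum.
a : ℕ → ℕ
a n = sum (map (term n) (upTo (suc n)))

-- Since (2k)!/(k! 2^k) = (2k-1)!!, the number m(n, k) = (2k-1)!! C(n, 2k) counts k-edge matchings
-- on n points and I(n) = Σ_k m(n, k) counts involutions of n points.  Pascal's rule
-- C(n+2, 2k+1) = C(n+1, 2k) + C(n+1, 2k+1) gives a(n+1) = a(n) + I(n+1), and removing the last
-- point gives the telephone recurrence I(n+2) = I(n+1) + (n+1) I(n).  Eliminating I from these two
-- recurrences yields the three-term recurrence for a.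
module Submission where

open import Defs
open import Data.Nat using (ℕ; suc)
open import Data.Integer using (ℤ; +_; _+_; _-_; _*_)
open import Data.Product using (_×_; _,_)
open import Relation.Binary.PropositionalEquality
  using (_≡_; refl; sym; trans; cong; cong₂; module ≡-Reasoning)
open import Data.Nat as ℕ using (zero; _≤_; _<_; z≤n; s≤s; _!; _^_; NonZero)
open import Data.Nat.Properties
  using (+-comm; +-assoc; *-zeroʳ; *-distribˡ-+; *-suc; *-identityˡ; *-identityʳ; n≤1+n; m≤m+n;
         ≤-trans; m*n≢0; m^n≢0; _!≢0)
open import Data.Integer.Properties using (pos-+; pos-*)
open import Data.Nat.Combinatorics using (_C_; nC1≡n; nCk+nC[k+1]≡[n+1]C[k+1])
open import Data.Nat.Combinatorics.Specification using (k>n⇒nCk≡0)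
open import Data.Nat.DivMod using (/-congˡ; m*n/n≡m)
open import Data.List using (map; applyUpTo)
open import Data.Nat.ListAction using (sum)
open import Function using (_∘_; id)
import Data.Nat.Tactic.RingSolver as ℕ-Solver
import Data.Integer.Tactic.RingSolver as ℤ-Solver

open ≡-Reasoning

∑< : ℕ → (ℕ → ℕ) → ℕ
∑< zero    f = 0
∑< (suc m) f = f 0 ℕ.+ ∑< m (f ∘ suc)

sum-map-applyUpTo : ∀ m (f g : ℕ → ℕ) → sum (map f (applyUpTo g m)) ≡ ∑< m (f ∘ g)
sum-map-applyUpTo zero    f g = refl
sum-map-applyUpTo (suc m) f g = cong (f (g 0) ℕ.+_) (sum-map-applyUpTo m f (g ∘ suc))

∑<-cong : ∀ m {f h : ℕ → ℕ} → (∀ k → f k ≡ h k) → ∑< m f ≡ ∑< m h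
∑<-cong zero    f≗h = refl
∑<-cong (suc m) f≗h = cong₂ ℕ._+_ (f≗h 0) (∑<-cong m (f≗h ∘ suc))

∑<-distrib-+ : ∀ m (f h : ℕ → ℕ) → ∑< m (λ k → f k ℕ.+ h k) ≡ ∑< m f ℕ.+ ∑< m h
∑<-distrib-+ zero    f h = refl
∑<-distrib-+ (suc m) f h = begin
  f 0 ℕ.+ h 0 ℕ.+ ∑< m (λ k → f (suc k) ℕ.+ h (suc k))
    ≡⟨ cong (f 0 ℕ.+ h 0 ℕ.+_) (∑<-distrib-+ m (f ∘ suc) (h ∘ suc)) ⟩
  f 0 ℕ.+ h 0 ℕ.+ (∑< m (f ∘ suc) ℕ.+ ∑< m (h ∘ suc))
    ≡⟨ interchange (f 0) (h 0) _ _ ⟩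
  f 0 ℕ.+ ∑< m (f ∘ suc) ℕ.+ (h 0 ℕ.+ ∑< m (h ∘ suc))
    ∎
  where
  interchange : ∀ a b c d → a ℕ.+ b ℕ.+ (c ℕ.+ d) ≡ a ℕ.+ c ℕ.+ (b ℕ.+ d)
  interchange = ℕ-Solver.solve-∀

∑<-distribˡ-* : ∀ m c (f : ℕ → ℕ) → ∑< m (λ k → c ℕ.* f k) ≡ c ℕ.* ∑< m f
∑<-distribˡ-* zero    c f = sym (*-zeroʳ c)
∑<-distribˡ-* (suc m) c f = trans (cong (c ℕ.* f 0 ℕ.+_) (∑<-distribˡ-* m c (f ∘ suc)))
                                  (sym (*-distribˡ-+ c (f 0) (∑< m (f ∘ suc))))

∑<-zero : ∀ m (f : ℕ → ℕ) → (∀ k → f k ≡ 0) → ∑< m f ≡ 0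
∑<-zero zero    f f≡0 = refl
∑<-zero (suc m) f f≡0 = cong₂ ℕ._+_ (f≡0 0) (∑<-zero m (f ∘ suc) (f≡0 ∘ suc))

∑<-vanishing-tail : ∀ {m m′} (f : ℕ → ℕ) → m ≤ m′ → (∀ k → m ≤ k → f k ≡ 0) → ∑< m′ f ≡ ∑< m f
∑<-vanishing-tail {m′ = m′} f z≤n       tail≡0 = ∑<-zero m′ f (λ k → tail≡0 k z≤n)
∑<-vanishing-tail           f (s≤s m≤m′) tail≡0 =
  cong (f 0 ℕ.+_) (∑<-vanishing-tail (f ∘ suc) m≤m′ (λ k m≤k → tail≡0 (suc k) (s≤s m≤k)))

[1+k]*[1+n]C[1+k]≡[1+n]*nCk : ∀ n k → suc k ℕ.* (suc n C suc k) ≡ suc n ℕ.* (n C k)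
[1+k]*[1+n]C[1+k]≡[1+n]*nCk zero    zero    = refl
[1+k]*[1+n]C[1+k]≡[1+n]*nCk zero    (suc k) = *-zeroʳ (suc (suc k))
[1+k]*[1+n]C[1+k]≡[1+n]*nCk (suc n) zero    =
  trans (*-identityˡ _) (trans (nC1≡n (suc (suc n))) (sym (*-identityʳ (suc (suc n)))))
[1+k]*[1+n]C[1+k]≡[1+n]*nCk (suc n) (suc k) = begin
  suc (suc k) ℕ.* (suc (suc n) C suc (suc k))
    ≡⟨ cong (suc (suc k) ℕ.*_) (sym (nCk+nC[k+1]≡[n+1]C[k+1] (suc n) (suc k))) ⟩
  suc (suc k) ℕ.* (suc n C suc k ℕ.+ suc n C suc (suc k))
    ≡⟨ *-distribˡ-+ (suc (suc k)) (suc n C suc k) _ ⟩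
  suc n C suc k ℕ.+ suc k ℕ.* (suc n C suc k) ℕ.+ suc (suc k) ℕ.* (suc n C suc (suc k))
    ≡⟨ cong₂ (λ p q → suc n C suc k ℕ.+ p ℕ.+ q) ([1+k]*[1+n]C[1+k]≡[1+n]*nCk n k)
                                                 ([1+k]*[1+n]C[1+k]≡[1+n]*nCk n (suc k)) ⟩
  suc n C suc k ℕ.+ suc n ℕ.* (n C k) ℕ.+ suc n ℕ.* (n C suc k)
    ≡⟨ +-assoc (suc n C suc k) _ _ ⟩
  suc n C suc k ℕ.+ (suc n ℕ.* (n C k) ℕ.+ suc n ℕ.* (n C suc k))
    ≡⟨ cong (suc n C suc k ℕ.+_) (sym (*-distribˡ-+ (suc n) (n C k) (n C suc k))) ⟩
  suc n C suc k ℕ.+ suc n ℕ.* (n C k ℕ.+ n C suc k)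
    ≡⟨ cong (λ p → suc n C suc k ℕ.+ suc n ℕ.* p) (nCk+nC[k+1]≡[n+1]C[k+1] n k) ⟩
  suc (suc n) ℕ.* (suc n C suc k)
    ∎

oddDoubleFactorial : ℕ → ℕ
oddDoubleFactorial zero    = 1
oddDoubleFactorial (suc k) = suc (2 ℕ.* k) ℕ.* oddDoubleFactorial k

[2k]!≡[2k-1]!!*k!*2^k : ∀ k → (2 ℕ.* k) ! ≡ oddDoubleFactorial k ℕ.* (k ! ℕ.* 2 ^ k)
[2k]!≡[2k-1]!!*k!*2^k zero    = refl
[2k]!≡[2k-1]!!*k!*2^k (suc k) = begin
  (2 ℕ.* suc k) !
    ≡⟨ cong _! (*-suc 2 k) ⟩
  suc (suc (2 ℕ.* k)) ℕ.* (suc (2 ℕ.* k) ℕ.* (2 ℕ.* k) !)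
    ≡⟨ cong (λ p → suc (suc (2 ℕ.* k)) ℕ.* (suc (2 ℕ.* k) ℕ.* p)) ([2k]!≡[2k-1]!!*k!*2^k k) ⟩
  suc (suc (2 ℕ.* k)) ℕ.* (suc (2 ℕ.* k) ℕ.* (oddDoubleFactorial k ℕ.* (k ! ℕ.* 2 ^ k)))
    ≡⟨ regroup k (oddDoubleFactorial k) (k !) (2 ^ k) ⟩
  oddDoubleFactorial (suc k) ℕ.* (suc k ! ℕ.* 2 ^ suc k)
    ∎
  where
  regroup : ∀ k d f p → suc (suc (2 ℕ.* k)) ℕ.* (suc (2 ℕ.* k) ℕ.* (d ℕ.* (f ℕ.* p)))
                      ≡ suc (2 ℕ.* k) ℕ.* d ℕ.* (suc k ℕ.* f ℕ.* (2 ℕ.* p))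
  regroup = ℕ-Solver.solve-∀

dfact≡oddDoubleFactorial : ∀ k → dfact k ≡ oddDoubleFactorial k
dfact≡oddDoubleFactorial k =
  trans (/-congˡ ([2k]!≡[2k-1]!!*k!*2^k k)) (m*n/n≡m (oddDoubleFactorial k) (k ! ℕ.* 2 ^ k))
  where
  instance
    k!*2^k≢0 : NonZero (k ! ℕ.* 2 ^ k)
    k!*2^k≢0 = m*n≢0 (k !) (2 ^ k) {{k !≢0}} {{m^n≢0 2 k}}

matchings : ℕ → ℕ → ℕ
matchings n k = oddDoubleFactorial k ℕ.* (n C (2 ℕ.* k))

involutions : ℕ → ℕ
involutions n = ∑< (suc n) (matchings n)

k≤2k : ∀ k → k ≤ 2 ℕ.* k
k≤2k k = m≤m+n k (k ℕ.+ 0)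

matchings-vanish : ∀ n k → n < k → matchings n k ≡ 0
matchings-vanish n k n<k =
  trans (cong (oddDoubleFactorial k ℕ.*_) (k>n⇒nCk≡0 (≤-trans n<k (k≤2k k)))) (*-zeroʳ (oddDoubleFactorial k))

-- The last point is either unmatched, or matched to one of the other n+1 points.
matchings-suc : ∀ n k → matchings (suc (suc n)) (suc k) ≡ matchings (suc n) (suc k) ℕ.+ suc n ℕ.* matchings n k
matchings-suc n k = begin
  oddDoubleFactorial (suc k) ℕ.* (suc (suc n) C (2 ℕ.* suc k))
    ≡⟨ cong (λ j → oddDoubleFactorial (suc k) ℕ.* (suc (suc n) C j)) (*-suc 2 k) ⟩
  oddDoubleFactorial (suc k) ℕ.* (suc (suc n) C suc (suc (2 ℕ.* k)))
    ≡⟨ cong (oddDoubleFactorial (suc k) ℕ.*_) (sym (nCk+nC[k+1]≡[n+1]C[k+1] (suc n) (suc (2 ℕ.* k)))) ⟩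
  suc (2 ℕ.* k) ℕ.* d ℕ.* (suc n C suc (2 ℕ.* k) ℕ.+ suc n C suc (suc (2 ℕ.* k)))
    ≡⟨ regroup (suc (2 ℕ.* k)) d (suc n C suc (2 ℕ.* k)) _ ⟩
  suc (2 ℕ.* k) ℕ.* d ℕ.* (suc n C suc (suc (2 ℕ.* k))) ℕ.+ d ℕ.* (suc (2 ℕ.* k) ℕ.* (suc n C suc (2 ℕ.* k)))
    ≡⟨ cong₂ (λ j p → oddDoubleFactorial (suc k) ℕ.* (suc n C j) ℕ.+ d ℕ.* p)
             (sym (*-suc 2 k)) ([1+k]*[1+n]C[1+k]≡[1+n]*nCk n (2 ℕ.* k)) ⟩
  matchings (suc n) (suc k) ℕ.+ d ℕ.* (suc n ℕ.* (n C (2 ℕ.* k)))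
    ≡⟨ cong (matchings (suc n) (suc k) ℕ.+_) (commute d (suc n) (n C (2 ℕ.* k))) ⟩
  matchings (suc n) (suc k) ℕ.+ suc n ℕ.* matchings n k
    ∎
  where
  d = oddDoubleFactorial k
  regroup : ∀ s d x y → s ℕ.* d ℕ.* (x ℕ.+ y) ≡ s ℕ.* d ℕ.* y ℕ.+ d ℕ.* (s ℕ.* x)
  regroup = ℕ-Solver.solve-∀
  commute : ∀ d m x → d ℕ.* (m ℕ.* x) ≡ m ℕ.* (d ℕ.* x)
  commute = ℕ-Solver.solve-∀

∑<-matchings : ∀ n {m} → suc n ≤ m → ∑< m (matchings n) ≡ involutions n
∑<-matchings n n<m = ∑<-vanishing-tail (matchings n) n<m (matchings-vanish n)

involutions-suc : ∀ n → involutions (suc (suc n)) ≡ involutions (suc n) ℕ.+ suc n ℕ.* involutions n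
involutions-suc n = begin
  1 ℕ.+ ∑< (suc (suc n)) (matchings (suc (suc n)) ∘ suc)
    ≡⟨ cong (1 ℕ.+_) (∑<-cong (suc (suc n)) (matchings-suc n)) ⟩
  1 ℕ.+ ∑< (suc (suc n)) (λ k → matchings (suc n) (suc k) ℕ.+ suc n ℕ.* matchings n k)
    ≡⟨ cong (1 ℕ.+_) (∑<-distrib-+ (suc (suc n)) (matchings (suc n) ∘ suc) (λ k → suc n ℕ.* matchings n k)) ⟩
  1 ℕ.+ (∑< (suc (suc n)) (matchings (suc n) ∘ suc) ℕ.+ ∑< (suc (suc n)) (λ k → suc n ℕ.* matchings n k))
    ≡⟨ sym (+-assoc 1 (∑< (suc (suc n)) (matchings (suc n) ∘ suc)) _) ⟩
  ∑< (suc (suc (suc n))) (matchings (suc n)) ℕ.+ ∑< (suc (suc n)) (λ k → suc n ℕ.* matchings n k)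
    ≡⟨ cong₂ ℕ._+_ (∑<-matchings (suc n) (n≤1+n _))
                   (trans (∑<-distribˡ-* (suc (suc n)) (suc n) (matchings n))
                          (cong (suc n ℕ.*_) (∑<-matchings n (n≤1+n _)))) ⟩
  involutions (suc n) ℕ.+ suc n ℕ.* involutions n
    ∎

term≡ : ∀ n k → term n k ≡ oddDoubleFactorial k ℕ.* (suc n C suc (2 ℕ.* k))
term≡ n k = cong₂ ℕ._*_ (dfact≡oddDoubleFactorial k) (cong₂ _C_ (+-comm n 1) (+-comm (2 ℕ.* k) 1))

term-vanish : ∀ n k → n < k → term n k ≡ 0
term-vanish n k n<k = begin
  term n k                                                ≡⟨ term≡ n k ⟩
  oddDoubleFactorial k ℕ.* (suc n C suc (2 ℕ.* k))        ≡⟨ cong (oddDoubleFactorial k ℕ.*_) (k>n⇒nCk≡0 (s≤s (≤-trans n<k (k≤2k k)))) ⟩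
  oddDoubleFactorial k ℕ.* 0                              ≡⟨ *-zeroʳ (oddDoubleFactorial k) ⟩
  0                                                       ∎

term-suc : ∀ n k → term (suc n) k ≡ matchings (suc n) k ℕ.+ term n k
term-suc n k = begin
  term (suc n) k
    ≡⟨ term≡ (suc n) k ⟩
  d ℕ.* (suc (suc n) C suc (2 ℕ.* k))
    ≡⟨ cong (d ℕ.*_) (sym (nCk+nC[k+1]≡[n+1]C[k+1] (suc n) (2 ℕ.* k))) ⟩
  d ℕ.* (suc n C (2 ℕ.* k) ℕ.+ suc n C suc (2 ℕ.* k))
    ≡⟨ *-distribˡ-+ d (suc n C (2 ℕ.* k)) _ ⟩
  matchings (suc n) k ℕ.+ d ℕ.* (suc n C suc (2 ℕ.* k))
    ≡⟨ cong (matchings (suc n) k ℕ.+_) (sym (term≡ n k)) ⟩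
  matchings (suc n) k ℕ.+ term n k
    ∎
  where d = oddDoubleFactorial k

a≡∑<term : ∀ n → a n ≡ ∑< (suc n) (term n)
a≡∑<term n = sum-map-applyUpTo (suc n) (term n) id

a-suc : ∀ n → a (suc n) ≡ a n ℕ.+ involutions (suc n)
a-suc n = begin
  a (suc n)
    ≡⟨ a≡∑<term (suc n) ⟩
  ∑< (suc (suc n)) (term (suc n))
    ≡⟨ ∑<-cong (suc (suc n)) (term-suc n) ⟩
  ∑< (suc (suc n)) (λ k → matchings (suc n) k ℕ.+ term n k)
    ≡⟨ ∑<-distrib-+ (suc (suc n)) (matchings (suc n)) (term n) ⟩
  involutions (suc n) ℕ.+ ∑< (suc (suc n)) (term n)
    ≡⟨ cong (involutions (suc n) ℕ.+_) (∑<-vanishing-tail (term n) (n≤1+n _) (term-vanish n)) ⟩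
  involutions (suc n) ℕ.+ ∑< (suc n) (term n)
    ≡⟨ cong (involutions (suc n) ℕ.+_) (sym (a≡∑<term n)) ⟩
  involutions (suc n) ℕ.+ a n
    ≡⟨ +-comm (involutions (suc n)) (a n) ⟩
  a n ℕ.+ involutions (suc n)
    ∎

partialSums-recurrence : ∀ (s t : ℕ → ℕ) →
  (∀ n → s (suc n) ≡ s n ℕ.+ t (suc n)) →
  (∀ n → t (suc (suc n)) ≡ t (suc n) ℕ.+ suc n ℕ.* t n) →
  ∀ n → s (3 ℕ.+ n) ℕ.+ (2 ℕ.+ n) ℕ.* s n ≡ 2 ℕ.* s (2 ℕ.+ n) ℕ.+ (1 ℕ.+ n) ℕ.* s (1 ℕ.+ n)
partialSums-recurrence s t s-suc t-suc n
  rewrite s-suc (2 ℕ.+ n) | t-suc (1 ℕ.+ n) | s-suc (1 ℕ.+ n) | s-suc n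
  = eliminate n (s n) (t (1 ℕ.+ n)) (t (2 ℕ.+ n))
  where
  eliminate : ∀ n s₀ t₁ t₂ → s₀ ℕ.+ t₁ ℕ.+ t₂ ℕ.+ (t₂ ℕ.+ (2 ℕ.+ n) ℕ.* t₁) ℕ.+ (2 ℕ.+ n) ℕ.* s₀
                           ≡ 2 ℕ.* (s₀ ℕ.+ t₁ ℕ.+ t₂) ℕ.+ (1 ℕ.+ n) ℕ.* (s₀ ℕ.+ t₁)
  eliminate = ℕ-Solver.solve-∀

+-balance⇒ℤ-difference : ∀ {w x y z} b c → w ℕ.+ c ℕ.* x ≡ 2 ℕ.* z ℕ.+ b ℕ.* y →
                         + w ≡ + 2 * + z + + b * + y - + c * + x
+-balance⇒ℤ-difference {w} {x} {y} {z} b c balance = begin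
  + w                                    ≡⟨ add-sub (+ w) (+ c * + x) ⟩
  + w + + c * + x - + c * + x            ≡⟨ cong (_- + c * + x) balanceℤ ⟩
  + 2 * + z + + b * + y - + c * + x      ∎
  where
  add-sub : ∀ p q → p ≡ p + q - q
  add-sub = ℤ-Solver.solve-∀
  balanceℤ : + w + + c * + x ≡ + 2 * + z + + b * + y
  balanceℤ = begin
    + w + + c * + x          ≡⟨ cong (λ q → + w + q) (pos-* c x) ⟨
    + w + + (c ℕ.* x)        ≡⟨ pos-+ w (c ℕ.* x) ⟨
    + (w ℕ.+ c ℕ.* x)        ≡⟨ cong +_ balance ⟩
    + (2 ℕ.* z ℕ.+ b ℕ.* y)  ≡⟨ pos-+ (2 ℕ.* z) (b ℕ.* y) ⟩
    + (2 ℕ.* z) + + (b ℕ.* y) ≡⟨ cong₂ _+_ (pos-* 2 z) (pos-* b y) ⟩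
    + 2 * + z + + b * + y    ∎

proposition5p1 : (a 0 ≡ 1) × (a 1 ≡ 2) × (a 2 ≡ 4) × ((n : ℕ) → + a (suc (suc (suc n))) ≡ + 2 * + a (suc (suc n)) + + (suc n) * + a (suc n) - + (suc (suc n)) * + a n)
proposition5p1 = refl , refl , refl , λ n →
  +-balance⇒ℤ-difference {a (3 ℕ.+ n)} {a n} {a (1 ℕ.+ n)} {a (2 ℕ.+ n)} (suc n) (suc (suc n))
    (partialSums-recurrence a involutions a-suc involutions-suc n)
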